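{- Let $F$ be a forest with vertex set $[n]$ and let $\pi$ be any linear ordering of its edges. Define $\alpha_{F,\pi} = n!\prod_{(i,j)\in E(F)}(1-(i\,j))\in\mathbb{C}[S_n]$, where the product is taken in the order prescribed by $\pi$ and $(i\,j)$ denotes a transposition. Then $\mathrm{ch}(\alpha_{F,\pi}) = X_F$.
   Context: $\Lambda$ denotes the ring of symmetric functions over $\mathbb{C}$, $p_\lambda$ the power sum symmetric functions. For $\sigma\in S_n$, $\mathrm{cyc}(\sigma)$ is the partition of $n$ given by the cycle lengths of $\sigma$. The Frobenius characteristic $\mathrm{ch}:\mathbb{C}[S_n]\to\Lambda$ is the linear map with $\mathrm{ch}(\sigma)=\frac{1}{n!}p_{\mathrm{cyc}(\sigma)}$ for $\sigma\in S_n$. For a finite simple graph $G$, a coloring $\kappa:V(G)\to\mathbb{N}$ is proper if adjacent vertices receive different colors, and the chromatic symmetric function is $X_G=\sum_\kappa\prod_{v\in V(G)}x_{\kappa(v)}$ summed over proper colorings. -}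

module Defs where

open import Data.Bool using (Bool; true; false; if_then_else_; _∧_)
open import Data.Nat as ℕ using (ℕ; zero; suc; _<_)
open import Data.Nat.Properties using (_!≢0)
open import Data.Fin as Fin using (Fin; toℕ)
open import Data.Fin.Properties using (_≟_)
open import Data.Fin.Permutation using (Permutation′; id; transpose; _∘ₚ_; _⟨$⟩ʳ_)
open import Data.List as List using (List; []; _∷_; [_]; _++_; map; concatMap; allFin; filter; length; upTo)
open import Data.Bool.ListAction using (and)
open import Data.List.Relation.Unary.Unique.Propositional using (Unique)
open import Data.List.Relation.Unary.All using (All)
open import Data.List.Membership.Propositional using (_∈_)
open import Data.Product using (_×_; _,_; proj₁; proj₂; ∃)
open import Data.Sum using (_⊎_)
open import Data.Integer as ℤ using (ℤ; +_)
open import Data.Rational as ℚ using (ℚ; _/_; 0ℚ; 1ℚ)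
open import Relation.Nullary using (¬_; does)
open import Relation.Nullary.Decidable using (⌊_⌋)
open import Relation.Binary.PropositionalEquality using (_≡_)

-- Simple graphs on [n] = Fin n given by an (ordered) list of edges.
-- An edge {i,j} is stored as (i , j) with i < j; the list order is the
-- linear ordering π of the edges.

EdgeList : ℕ → Set
EdgeList n = List (Fin n × Fin n)

SimpleEdges : ∀ {n} → EdgeList n → Set
SimpleEdges E = All (λ e → toℕ (proj₁ e) < toℕ (proj₂ e)) E × Unique E

Adj : ∀ {n} → EdgeList n → Fin n → Fin n → Set
Adj E u v = ((u , v) ∈ E) ⊎ ((v , u) ∈ E)

Chain : ∀ {n} → EdgeList n → List (Fin n) → Set
Chain E []           = Data.Unit.⊤ where import Data.Unit
Chain E (u ∷ [])     = Data.Unit.⊤ where import Data.Unit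
Chain E (u ∷ v ∷ vs) = Adj E u v × Chain E (v ∷ vs)

IsCycle : ∀ {n} → EdgeList n → List (Fin n) → Set
IsCycle E []       = Data.Empty.⊥ where import Data.Empty
IsCycle E (v ∷ vs) = 3 ℕ.≤ length (v ∷ vs) × Unique (v ∷ vs) × Chain E ((v ∷ vs) ++ [ v ])

IsForest : ∀ {n} → EdgeList n → Set
IsForest E = SimpleEdges E × ¬ (∃ λ vs → IsCycle E vs)

-- The group algebra ℚ[S_n] (coefficients of α lie in ℤ ⊂ ℂ), elements
-- represented by formal sums Σ c_σ σ given as lists of (c_σ , σ).

GA : ℕ → Set
GA n = List (ℚ × Permutation′ n)

oneGA : ∀ {n} → GA n
oneGA = (1ℚ , id) ∷ []

scaleGA : ∀ {n} → ℚ → GA n → GA n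
scaleGA c = map (λ t → (c ℚ.* proj₁ t , proj₂ t))

-- product in ℚ[S_n]; (σ τ)(i) = σ (τ i), i.e. τ ∘ₚ σ in diagrammatic notation
mulGA : ∀ {n} → GA n → GA n → GA n
mulGA a b = concatMap (λ s → map (λ t → (proj₁ s ℚ.* proj₁ t , proj₂ t ∘ₚ proj₂ s)) b) a

factor : ∀ {n} → Fin n × Fin n → GA n
factor (i , j) = (1ℚ , id) ∷ (ℚ.- 1ℚ , transpose i j) ∷ []

alpha : ∀ n → EdgeList n → GA n
alpha n E = scaleGA ((+ (n ℕ.!)) / 1) (List.foldr (λ e acc → mulGA (factor e) acc) oneGA E)

iter : ∀ {n} → Permutation′ n → ℕ → Fin n → Fin n
iter σ zero    i = i
iter σ (suc k) i = σ ⟨$⟩ʳ (iter σ k i)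

-- least k ≥ 1 with σ^k(i) = i (searching k = start, start+1, …, with fuel;
-- fuel n suffices since the cycle length is ≤ n)
firstReturn : ∀ {n} → Permutation′ n → Fin n → ℕ → ℕ → ℕ
firstReturn σ i zero       k = k
firstReturn σ i (suc fuel) k = if ⌊ iter σ k i ≟ i ⌋ then k else firstReturn σ i fuel (suc k)

cycLen : ∀ {n} → Permutation′ n → Fin n → ℕ
cycLen {n} σ i = firstReturn σ i n 1

isCycleMin : ∀ {n} → Permutation′ n → Fin n → Bool
isCycleMin σ i = and (map (λ k → ⌊ toℕ i ℕ.≤? toℕ (iter σ k i) ⌋) (upTo (cycLen σ i)))

cyc : ∀ {n} → Permutation′ n → List ℕ
cyc {n} σ = map (cycLen σ) (filter (λ i → isCycleMin σ i Data.Bool.≟ true) (allFin n))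
  where import Data.Bool

-- Symmetric functions, represented by their specialisations to finitely
-- many variables x₁,…,x_m (m arbitrary) evaluated at points of ℚ^m.

sumℚ : List ℚ → ℚ
sumℚ = List.foldr ℚ._+_ 0ℚ

prodℚ : List ℚ → ℚ
prodℚ = List.foldr ℚ._*_ 1ℚ

_^ℚ_ : ℚ → ℕ → ℚ
x ^ℚ zero  = 1ℚ
x ^ℚ suc k = x ℚ.* (x ^ℚ k)

powerSum : ∀ {m} → ℕ → (Fin m → ℚ) → ℚ
powerSum {m} k x = sumℚ (map (λ c → x c ^ℚ k) (allFin m))

powerSumP : ∀ {m} → List ℕ → (Fin m → ℚ) → ℚ
powerSumP λs x = prodℚ (map (λ k → powerSum k x) λs)

ch : ∀ {n m} → GA n → (Fin m → ℚ) → ℚ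
ch {n} a x = sumℚ (map (λ t → proj₁ t ℚ.* (_/_ (+ 1) (n ℕ.!) {{n !≢0}}) ℚ.* powerSumP (cyc (proj₂ t)) x) a)

allFuns : ∀ n m → List (Fin n → Fin m)
allFuns zero    m = (λ ()) ∷ []
allFuns (suc n) m = concatMap (λ c → map (λ f → λ { Fin.zero → c ; (Fin.suc i) → f i }) (allFuns n m)) (allFin m)

proper : ∀ {n m} → EdgeList n → (Fin n → Fin m) → Bool
proper E κ = and (map (λ e → Data.Bool.not ⌊ κ (proj₁ e) ≟ κ (proj₂ e) ⌋) E)
  where import Data.Bool

chromatic : ∀ {n m} → EdgeList n → (Fin m → ℚ) → ℚ
chromatic {n} {m} E x =
  sumℚ (map (λ κ → prodℚ (map (λ v → x (κ v)) (allFin n))) (filter (λ κ → proper E κ Data.Bool.≟ true) (allFuns n m)))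
  where import Data.Bool

-- Expanding the product, α_{F,π} = n! Σ c_σ σ, and ch sends σ to p_{cyc σ} / n!. At x₁,…,x_m the
-- power sum p_{cyc σ} is the sum of the monomials x^κ over the colourings κ : [n] → [m] that are
-- constant on the cycles of σ, since a sum over class-constant colourings factorises over the
-- classes. Exchanging the two sums, ch(α_{F,π}) = Σ_κ S_κ x^κ, where S_κ is the total coefficient
-- of the expansion on the permutations fixing κ; and S_κ = [κ proper] by induction along the edge
-- list. The factor 1 − (i j) turns S_κ into S_κ − S′_κ, with S′_κ taken over the products of the
-- later terms σ with (i j). If κ(i) = κ(j), such a product fixes κ iff σ does, so S′_κ = S_κ.
-- Otherwise σ moves vertices only inside components of the remaining forest, which separate i
-- from j, so the product has i and j in one cycle and does not fix κ: S′_κ = 0.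

module Submission where

open import Defs
open import Algebra.Bundles using (CommutativeSemigroup)
open import Algebra.Core using (Op₂)
open import Algebra.Structures using (IsCommutativeMonoid)
open import Data.Bool using (Bool; true; false; if_then_else_; _∧_; T)
import Data.Bool
open import Data.Bool.Properties using (T-≡)
open import Data.Empty using (⊥-elim)
open import Data.Fin using (Fin; zero; suc; toℕ; _≤_; fromℕ<; inject)
open import Data.Fin.Permutation using (Permutation′; id; transpose; _∘ₚ_; _⟨$⟩ʳ_; _⟨$⟩ˡ_; inverseˡ)
open import Data.Fin.Properties
  using (_≟_; _≤?_; all?; any?; ¬Fin0; ¬∀⟶∃¬-smallest; pigeonhole; ≤-antisym; toℕ<n; toℕ-injective;
         toℕ-inject; toℕ-fromℕ<)
import Data.Integer as ℤ
open import Data.List using (List; []; _∷_; [_]; _++_; map; concatMap; filter; foldr; allFin; applyUpTo; upTo; length)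
import Data.List.Properties as Listₚ
open import Data.List.Membership.Propositional using (_∈_)
open import Data.List.Membership.Propositional.Properties using (∈-applyUpTo⁺; ∈-applyUpTo⁻)
open import Data.List.Relation.Unary.All as All using (All; []; _∷_)
open import Data.List.Relation.Unary.All.Properties as Allₚ
  using (all⁺; all⁻; applyUpTo⁺₁; applyUpTo⁻; All¬⇒¬Any; ¬Any⇒All¬)
open import Data.List.Relation.Unary.AllPairs using ([]; _∷_)
open import Data.List.Relation.Unary.Any as Any using (here; there)
open import Data.List.Relation.Unary.Unique.Propositional using (Unique)
import Data.List.Relation.Unary.Unique.Propositional.Properties as Unique
open import Data.Nat as ℕ using (ℕ; zero; suc; z≤n; s≤s)
open import Data.Nat.Coprimality using (1-coprimeTo)
import Data.Nat.Coprimality as Coprime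
open import Data.Nat.DivMod using (_%_; m≡m%n+[m/n]*n; m%n<n) renaming (_/_ to _/ℕ_)
import Data.Nat.Properties as ℕₚ
open import Data.Nat.Properties using (_!≢0)
open import Data.Product using (∃; ∃-syntax; _,_; _×_; proj₁; proj₂)
open import Data.Rational using (ℚ; mkℚ; 0ℚ; 1ℚ; _+_; _*_; -_; _/_)
open import Data.Rational.Properties
  using (+-0-isCommutativeMonoid; *-1-isCommutativeMonoid; *-zeroˡ; *-zeroʳ; *-distribˡ-+; *-comm; neg-distrib-+;
         *-identityˡ; *-identityʳ; +-identityʳ; +-inverseʳ; normalize-coprime; *-inverseʳ)
open import Data.Rational.Solver using (module +-*-Solver)
open import Data.Sum as Sum using (_⊎_; inj₁; inj₂)
open import Data.Unit using (tt)
import Data.Vec.Functional as Vector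
open import Function using (_∘_; _⇔_; mk⇔; Equivalence)
open import Level using (0ℓ)
open import Relation.Binary.Core using (Rel; _Preserves_⟶_)
open import Relation.Binary.Structures using (IsDecEquivalence)
import Relation.Binary.Construct.On as On
open import Relation.Binary.Construct.Closure.ReflexiveTransitive as Star using (Star; ε; _◅_; _◅◅_)
open import Relation.Binary.PropositionalEquality
  using (_≡_; _≢_; refl; sym; trans; cong; cong₂; subst; _≗_; module ≡-Reasoning)
open import Relation.Nullary using (Dec; does; yes; no; ¬_; ¬?; _→-dec_; _×-dec_)
open import Relation.Nullary.Decidable
  using (⌊_⌋; map′; does-⇔; dec-true; dec-false; decidable-stable; toWitness; fromWitness)
import Relation.Nullary.Decidable as Dec
open import Relation.Unary using (Pred)

open +-*-Solver using (solve; _:=_; _:*_; :-_; con)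
open ≡-Reasoning

module BigOperator {a} {A : Set a} {_∙_ : Op₂ A} {ε : A} (isCM : IsCommutativeMonoid _≡_ _∙_ ε) where
  open IsCommutativeMonoid isCM using (assoc; identityˡ; identityʳ; isCommutativeSemigroup)

  private
    commutativeSemigroup : CommutativeSemigroup a a
    commutativeSemigroup = record { isCommutativeSemigroup = isCommutativeSemigroup }

  open import Algebra.Properties.CommutativeSemigroup commutativeSemigroup using (interchange; x∙yz≈y∙xz)

  ⨁ : List A → A
  ⨁ = foldr _∙_ ε

  module _ {b} {B : Set b} where

    ⨁-cong : {f g : B → A} → f ≗ g → ∀ xs → ⨁ (map f xs) ≡ ⨁ (map g xs)
    ⨁-cong f≗g xs = cong ⨁ (Listₚ.map-cong f≗g xs)

    ⨁-++ : (f : B → A) (xs ys : List B) → ⨁ (map f (xs ++ ys)) ≡ ⨁ (map f xs) ∙ ⨁ (map f ys)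
    ⨁-++ f [] ys = sym (identityˡ _)
    ⨁-++ f (x ∷ xs) ys = trans (cong (f x ∙_) (⨁-++ f xs ys)) (sym (assoc _ _ _))

    ⨁-ε : (xs : List B) → ⨁ (map (λ _ → ε) xs) ≡ ε
    ⨁-ε [] = refl
    ⨁-ε (x ∷ xs) = trans (identityˡ _) (⨁-ε xs)

    ⨁-ε-All : {f : B → A} {xs : List B} → All (λ x → f x ≡ ε) xs → ⨁ (map f xs) ≡ ε
    ⨁-ε-All [] = refl
    ⨁-ε-All (fx≡ε ∷ rest) = trans (cong₂ _∙_ fx≡ε (⨁-ε-All rest)) (identityˡ ε)

    ⨁-∙ : (f g : B → A) (xs : List B) → ⨁ (map (λ x → f x ∙ g x) xs) ≡ ⨁ (map f xs) ∙ ⨁ (map g xs)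
    ⨁-∙ f g [] = sym (identityˡ ε)
    ⨁-∙ f g (x ∷ xs) = trans (cong ((f x ∙ g x) ∙_) (⨁-∙ f g xs)) (interchange _ _ _ _)

    ⨁-if : (b : Bool) (f : B → A) (xs : List B) →
      ⨁ (map (λ x → if b then f x else ε) xs) ≡ (if b then ⨁ (map f xs) else ε)
    ⨁-if true f xs = refl
    ⨁-if false f xs = ⨁-ε xs

    ⨁-filter : ∀ {p} {P : Pred B p} (P? : ∀ x → Dec (P x)) (f : B → A) (xs : List B) →
      ⨁ (map f (filter P? xs)) ≡ ⨁ (map (λ x → if does (P? x) then f x else ε) xs)
    ⨁-filter P? f [] = refl
    ⨁-filter P? f (x ∷ xs) with does (P? x)
    ... | true = cong (f x ∙_) (⨁-filter P? f xs)
    ... | false = trans (⨁-filter P? f xs) (sym (identityˡ _))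

  module _ {b c} {B : Set b} {C : Set c} where

    ⨁-concatMap : (f : C → A) (g : B → List C) (xs : List B) →
      ⨁ (map f (concatMap g xs)) ≡ ⨁ (map (λ x → ⨁ (map f (g x))) xs)
    ⨁-concatMap f g [] = refl
    ⨁-concatMap f g (x ∷ xs) =
      trans (⨁-++ f (g x) (concatMap g xs)) (cong (⨁ (map f (g x)) ∙_) (⨁-concatMap f g xs))

    ⨁-comm : (f : B → C → A) (xs : List B) (ys : List C) →
      ⨁ (map (λ x → ⨁ (map (f x) ys)) xs) ≡ ⨁ (map (λ y → ⨁ (map (λ x → f x y) xs)) ys)
    ⨁-comm f [] ys = sym (⨁-ε ys)
    ⨁-comm f (x ∷ xs) ys =
      trans (cong (⨁ (map (f x) ys) ∙_) (⨁-comm f xs ys)) (sym (⨁-∙ (f x) _ ys))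

  ⨁-allFin-suc : ∀ {n} (f : Fin (ℕ.suc n) → A) →
    ⨁ (map f (allFin (ℕ.suc n))) ≡ f zero ∙ ⨁ (map (f ∘ suc) (allFin n))
  ⨁-allFin-suc f = cong (λ xs → f zero ∙ ⨁ xs)
    (trans (Listₚ.map-tabulate suc f) (sym (Listₚ.map-tabulate (λ i → i) (f ∘ suc))))

  ⨁-update : ∀ {n} (w : Fin n) (h g : Fin n → A) →
    ⨁ (map (λ v → if does (v ≟ w) then h v ∙ g v else g v) (allFin n)) ≡ h w ∙ ⨁ (map g (allFin n))
  ⨁-update zero h g = begin
    ⨁ (map (λ v → if does (v ≟ zero) then h v ∙ g v else g v) (allFin _))
      ≡⟨ ⨁-allFin-suc (λ v → if does (v ≟ zero) then h v ∙ g v else g v) ⟩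
    (h zero ∙ g zero) ∙ ⨁ (map (g ∘ suc) (allFin _)) ≡⟨ assoc _ _ _ ⟩
    h zero ∙ (g zero ∙ ⨁ (map (g ∘ suc) (allFin _))) ≡⟨ cong (h zero ∙_) (sym (⨁-allFin-suc g)) ⟩
    h zero ∙ ⨁ (map g (allFin _)) ∎
  ⨁-update (suc w) h g = begin
    ⨁ (map (λ v → if does (v ≟ suc w) then h v ∙ g v else g v) (allFin _))
      ≡⟨ ⨁-allFin-suc (λ v → if does (v ≟ suc w) then h v ∙ g v else g v) ⟩
    g zero ∙ ⨁ (map (λ v → if does (suc v ≟ suc w) then h (suc v) ∙ g (suc v) else g (suc v)) (allFin _))
      ≡⟨ cong (g zero ∙_) (⨁-update w (h ∘ suc) (g ∘ suc)) ⟩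
    g zero ∙ (h (suc w) ∙ ⨁ (map (g ∘ suc) (allFin _))) ≡⟨ x∙yz≈y∙xz _ _ _ ⟩
    h (suc w) ∙ (g zero ∙ ⨁ (map (g ∘ suc) (allFin _))) ≡⟨ cong (h (suc w) ∙_) (sym (⨁-allFin-suc g)) ⟩
    h (suc w) ∙ ⨁ (map g (allFin _)) ∎

  ⨁-delta : ∀ {n} (w : Fin n) (f : Fin n → A) →
    ⨁ (map (λ v → if does (v ≟ w) then f v else ε) (allFin n)) ≡ f w
  ⨁-delta {n} w f = begin
    ⨁ (map (λ v → if does (v ≟ w) then f v else ε) (allFin n))
      ≡⟨ ⨁-cong (λ v → cong (λ z → if does (v ≟ w) then z else ε) (sym (identityʳ (f v)))) (allFin n) ⟩
    ⨁ (map (λ v → if does (v ≟ w) then f v ∙ ε else ε) (allFin n)) ≡⟨ ⨁-update w f (λ _ → ε) ⟩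
    f w ∙ ⨁ (map (λ _ → ε) (allFin n))                    ≡⟨ cong (f w ∙_) (⨁-ε (allFin n)) ⟩
    f w ∙ ε                                               ≡⟨ identityʳ (f w) ⟩
    f w ∎

  ⨁-allFuns-suc : ∀ {n m} (F : (Fin (ℕ.suc n) → Fin m) → A) → F Preserves _≗_ ⟶ _≡_ →
    ⨁ (map F (allFuns (ℕ.suc n) m)) ≡ ⨁ (map (λ c → ⨁ (map (λ κ → F (c Vector.∷ κ)) (allFuns n m))) (allFin m))
  ⨁-allFuns-suc {n} {m} F F-ext = trans (⨁-concatMap F _ (allFin m))
    (⨁-cong (λ c → trans (cong ⨁ (sym (Listₚ.map-∘ (allFuns n m))))
                         (⨁-cong (λ κ → F-ext λ { zero → refl ; (suc i) → refl }) (allFuns n m)))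
            (allFin m))

open BigOperator +-0-isCommutativeMonoid
  using ()
  renaming (⨁-cong to sum-cong; ⨁-++ to sum-++; ⨁-ε-All to sum-0-All; ⨁-if to sum-if; ⨁-filter to sum-filter;
            ⨁-comm to sum-comm; ⨁-delta to sum-delta; ⨁-allFuns-suc to sum-allFuns-suc)
open BigOperator *-1-isCommutativeMonoid
  using ()
  renaming (⨁-cong to prod-cong; ⨁-ε to prod-1; ⨁-filter to prod-filter; ⨁-allFin-suc to prod-allFin-suc;
            ⨁-update to prod-update)

module _ {b} {B : Set b} where

  sum-*ˡ : (c : ℚ) (f : B → ℚ) (xs : List B) → sumℚ (map (λ x → c * f x) xs) ≡ c * sumℚ (map f xs)
  sum-*ˡ c f [] = sym (*-zeroʳ c)
  sum-*ˡ c f (x ∷ xs) = trans (cong (c * f x +_) (sum-*ˡ c f xs)) (sym (*-distribˡ-+ c _ _))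

  sum-*ʳ : (c : ℚ) (f : B → ℚ) (xs : List B) → sumℚ (map (λ x → f x * c) xs) ≡ sumℚ (map f xs) * c
  sum-*ʳ c f xs = trans (sum-cong (λ x → *-comm (f x) c) xs) (trans (sum-*ˡ c f xs) (*-comm c _))

  sum-neg : (f : B → ℚ) (xs : List B) → sumℚ (map (λ x → - f x) xs) ≡ - sumℚ (map f xs)
  sum-neg f [] = refl
  sum-neg f (x ∷ xs) = trans (cong (- f x +_) (sum-neg f xs)) (sym (neg-distrib-+ (f x) _))

if-*ˡ : (b : Bool) (c w : ℚ) → (if b then c * w else 0ℚ) ≡ c * (if b then w else 0ℚ)
if-*ˡ true c w = refl
if-*ˡ false c w = sym (*-zeroʳ c)

colourWeight : ∀ {n m} → (Fin n → Fin m → ℚ) → (Fin n → Fin m) → ℚ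
colourWeight {n} y κ = prodℚ (map (λ v → y v (κ v)) (allFin n))

colourMonomial : ∀ {n m} → (Fin m → ℚ) → (Fin n → Fin m) → ℚ
colourMonomial x = colourWeight (λ _ c → x c)

module ClassColourings {n : ℕ} {_∼_ : Rel (Fin n) 0ℓ} (isDecEquivalence : IsDecEquivalence _∼_) where
  open IsDecEquivalence isDecEquivalence public
    using () renaming (_≟_ to _∼?_; refl to ∼-refl; sym to ∼-sym; trans to ∼-trans)

  ClassConstant : ∀ {m} → (Fin n → Fin m) → Set
  ClassConstant κ = κ Preserves _∼_ ⟶ _≡_

  classConstant? : ∀ {m} (κ : Fin n → Fin m) → Dec (ClassConstant κ)
  classConstant? κ = map′ (λ h {u} {v} → h u v) (λ h u v → h)
                          (all? λ u → all? λ v → (u ∼? v) →-dec (κ u ≟ κ v))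

  ClassMin : Fin n → Set
  ClassMin v = ∀ u → u ∼ v → v ≤ u

  classMin? : ∀ v → Dec (ClassMin v)
  classMin? v = all? λ u → (u ∼? v) →-dec (v ≤? u)

  classMin-exists : ∀ v → ∃ λ ρ → ρ ∼ v × ClassMin ρ
  classMin-exists v with ¬∀⟶∃¬-smallest n (λ u → ¬ u ∼ v) (λ u → ¬? (u ∼? v)) (λ h → h v ∼-refl)
  ... | ρ , ¬¬ρ∼v , below = ρ , ρ∼v , λ u u∼ρ → ℕₚ.≮⇒≥ λ u<ρ →
          below (fromℕ< u<ρ) (subst (_∼ v) (sym (inject-fromℕ< u<ρ)) (∼-trans u∼ρ ρ∼v))
    where
    ρ∼v = decidable-stable (ρ ∼? v) ¬¬ρ∼v
    inject-fromℕ< : ∀ {u} (u<ρ : toℕ u ℕ.< toℕ ρ) → inject (fromℕ< u<ρ) ≡ u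
    inject-fromℕ< u<ρ = toℕ-injective (trans (toℕ-inject (fromℕ< u<ρ)) (toℕ-fromℕ< u<ρ))

  classMin-unique : ∀ {ρ ρ′} → ClassMin ρ → ClassMin ρ′ → ρ ∼ ρ′ → ρ ≡ ρ′
  classMin-unique {ρ} {ρ′} min min′ ρ∼ρ′ = ≤-antisym (min ρ′ (∼-sym ρ∼ρ′)) (min′ ρ ρ∼ρ′)

  module _ {m : ℕ} (y : Fin n → Fin m → ℚ) where

    classWeight : Fin n → Fin m → ℚ
    classWeight v c = prodℚ (map (λ u → if does (u ∼? v) then y u c else 1ℚ) (allFin n))

    classSum : Fin n → ℚ
    classSum v = sumℚ (map (classWeight v) (allFin m))

    classMinFactor : Fin n → ℚ
    classMinFactor v = if does (classMin? v) then classSum v else 1ℚ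

    classConstantTerm : (Fin n → Fin m) → ℚ
    classConstantTerm κ = if does (classConstant? κ) then colourWeight y κ else 0ℚ

    classConstantSum : ℚ
    classConstantSum = sumℚ (map classConstantTerm (allFuns n m))

    classMinProduct : ℚ
    classMinProduct = prodℚ (map classMinFactor (allFin n))

    classConstantTerm-cong : classConstantTerm Preserves _≗_ ⟶ _≡_
    classConstantTerm-cong {κ} {κ′} κ≗κ′ =
      cong₂ (λ b w → if b then w else 0ℚ)
            (does-⇔ (mk⇔ (λ h {u} {v} r → trans (sym (κ≗κ′ u)) (trans (h r) (κ≗κ′ v)))
                         (λ h {u} {v} r → trans (κ≗κ′ u) (trans (h r) (sym (κ≗κ′ v)))))
                    (classConstant? κ) (classConstant? κ′))
            (prod-cong (λ v → cong (y v) (κ≗κ′ v)) (allFin n))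

if-∧ : ∀ {a} {A : Set a} (b b′ : Bool) {x z : A} →
  (if b ∧ b′ then x else z) ≡ (if b then (if b′ then x else z) else z)
if-∧ true b′ = refl
if-∧ false b′ = refl

-- Induction step on the number of vertices: vertex 0 is either alone in its class, or linked to a
-- vertex suc w, in which case a class-constant colouring gives 0 the colour of w, and the weights of
-- 0 can be absorbed into those of w.
module ClassStep {n m : ℕ} {_∼_ : Rel (Fin (ℕ.suc n)) 0ℓ} (isDecEquivalence : IsDecEquivalence _∼_)
                 (y : Fin (ℕ.suc n) → Fin m → ℚ) where
  open ClassColourings isDecEquivalence
  module Tail = ClassColourings (On.isDecEquivalence suc isDecEquivalence)

  colourWeight-cons : ∀ c κ → colourWeight y (c Vector.∷ κ) ≡ y zero c * colourWeight (y ∘ suc) κ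
  colourWeight-cons c κ = prod-allFin-suc (λ v → y v ((c Vector.∷ κ) v))

  classMinProduct-suc : classMinProduct y ≡ classSum y zero * prodℚ (map (classMinFactor y ∘ suc) (allFin n))
  classMinProduct-suc = trans (prod-allFin-suc (classMinFactor y))
    (cong (λ b → (if b then classSum y zero else 1ℚ) * prodℚ (map (classMinFactor y ∘ suc) (allFin n)))
          (dec-true (classMin? zero) (λ _ _ → z≤n)))

  classWeight-zero : ∀ c → classWeight y zero c
    ≡ y zero c * prodℚ (map (λ u → if does (suc u ∼? zero) then y (suc u) c else 1ℚ) (allFin n))
  classWeight-zero c = trans (prod-allFin-suc (λ u → if does (u ∼? zero) then y u c else 1ℚ))
    (cong (λ b → (if b then y zero c else 1ℚ) * rest) (dec-true (zero ∼? zero) ∼-refl))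
    where rest = prodℚ (map (λ u → if does (suc u ∼? zero) then y (suc u) c else 1ℚ) (allFin n))

  classMin-suc : ∀ {v} → ¬ zero ∼ suc v → Tail.ClassMin v ⇔ ClassMin (suc v)
  classMin-suc ¬link = mk⇔ (λ { h zero r → ⊥-elim (¬link r) ; h (suc u) r → s≤s (h u r) })
                           (λ h u r → ℕ.s≤s⁻¹ (h (suc u) r))

  classSum-suc : ∀ {v} → ¬ zero ∼ suc v → Tail.classSum (y ∘ suc) v ≡ classSum y (suc v)
  classSum-suc {v} ¬link = sum-cong (λ c → sym (begin
    classWeight y (suc v) c
      ≡⟨ prod-allFin-suc (λ u → if does (u ∼? suc v) then y u c else 1ℚ) ⟩
    (if does (zero ∼? suc v) then y zero c else 1ℚ) * Tail.classWeight (y ∘ suc) v c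
      ≡⟨ cong (λ b → (if b then y zero c else 1ℚ) * Tail.classWeight (y ∘ suc) v c)
              (dec-false (zero ∼? suc v) ¬link) ⟩
    1ℚ * Tail.classWeight (y ∘ suc) v c
      ≡⟨ *-identityˡ _ ⟩
    Tail.classWeight (y ∘ suc) v c ∎)) (allFin m)

  classMinFactor-suc : ∀ {v} → ¬ zero ∼ suc v → Tail.classMinFactor (y ∘ suc) v ≡ classMinFactor y (suc v)
  classMinFactor-suc {v} ¬link = cong₂ (λ b s → if b then s else 1ℚ)
    (does-⇔ (classMin-suc ¬link) (Tail.classMin? v) (classMin? (suc v))) (classSum-suc ¬link)

  module Isolated (isolated : ∀ w → ¬ zero ∼ suc w) where

    classConstant-cons : ∀ c (κ : Fin n → Fin m) → Tail.ClassConstant κ ⇔ ClassConstant (c Vector.∷ κ)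
    classConstant-cons c κ = mk⇔
      (λ { h {zero} {zero} _ → refl
         ; h {zero} {suc v} r → ⊥-elim (isolated v r)
         ; h {suc u} {zero} r → ⊥-elim (isolated u (∼-sym r))
         ; h {suc u} {suc v} r → h r })
      (λ h {u} {v} → h {suc u} {suc v})

    classConstantTerm-cons : ∀ c κ → classConstantTerm y (c Vector.∷ κ) ≡ y zero c * Tail.classConstantTerm (y ∘ suc) κ
    classConstantTerm-cons c κ = trans
      (cong₂ (λ b p → if b then p else 0ℚ)
             (sym (does-⇔ (classConstant-cons c κ) (Tail.classConstant? κ) (classConstant? (c Vector.∷ κ))))
             (colourWeight-cons c κ))
      (if-*ˡ _ (y zero c) _)

    classSum-zero : classSum y zero ≡ sumℚ (map (y zero) (allFin m))
    classSum-zero = sum-cong (λ c → trans (classWeight-zero c) (trans (cong (y zero c *_) (others c)) (*-identityʳ _))) (allFin m)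
      where
      others : ∀ c → prodℚ (map (λ u → if does (suc u ∼? zero) then y (suc u) c else 1ℚ) (allFin n)) ≡ 1ℚ
      others c = trans (prod-cong (λ u → cong (λ b → if b then y (suc u) c else 1ℚ)
                                              (dec-false (suc u ∼? zero) (isolated u ∘ ∼-sym))) (allFin n))
                       (prod-1 (allFin n))

    step : Tail.classConstantSum (y ∘ suc) ≡ Tail.classMinProduct (y ∘ suc) → classConstantSum y ≡ classMinProduct y
    step ih = begin
      classConstantSum y
        ≡⟨ sum-allFuns-suc (classConstantTerm y) (classConstantTerm-cong y) ⟩
      sumℚ (map (λ c → sumℚ (map (λ κ → classConstantTerm y (c Vector.∷ κ)) (allFuns n m))) (allFin m))
        ≡⟨ sum-cong (λ c → trans (sum-cong (classConstantTerm-cons c) (allFuns n m))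
                                 (sum-*ˡ (y zero c) (Tail.classConstantTerm (y ∘ suc)) (allFuns n m))) (allFin m) ⟩
      sumℚ (map (λ c → y zero c * Tail.classConstantSum (y ∘ suc)) (allFin m))
        ≡⟨ sum-*ʳ _ (y zero) (allFin m) ⟩
      sumℚ (map (y zero) (allFin m)) * Tail.classConstantSum (y ∘ suc)
        ≡⟨ cong₂ _*_ (sym classSum-zero) ih ⟩
      classSum y zero * Tail.classMinProduct (y ∘ suc)
        ≡⟨ cong (classSum y zero *_) (prod-cong (λ v → classMinFactor-suc (isolated v)) (allFin n)) ⟩
      classSum y zero * prodℚ (map (classMinFactor y ∘ suc) (allFin n))
        ≡⟨ sym classMinProduct-suc ⟩
      classMinProduct y ∎

  module Linked {w : Fin n} (link : zero ∼ suc w) where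

    absorbed : Fin n → Fin m → ℚ
    absorbed v c = if does (v ≟ w) then y zero c * y (suc v) c else y (suc v) c

    classConstant-cons : ∀ c (κ : Fin n → Fin m) → (Tail.ClassConstant κ × c ≡ κ w) ⇔ ClassConstant (c Vector.∷ κ)
    classConstant-cons c κ = mk⇔
      (λ { (h , c≡κw) {zero} {zero} _ → refl
         ; (h , c≡κw) {zero} {suc v} r → trans c≡κw (h (∼-trans (∼-sym link) r))
         ; (h , c≡κw) {suc u} {zero} r → trans (h (∼-trans r link)) (sym c≡κw)
         ; (h , _) {suc u} {suc v} r → h r })
      (λ h → (λ {u} {v} → h {suc u} {suc v}) , h link)

    pinnedTerm : (Fin n → Fin m) → Fin m → ℚ
    pinnedTerm κ c = if does (Tail.classConstant? κ)
                     then (if does (c ≟ κ w) then y zero c * colourWeight (y ∘ suc) κ else 0ℚ) else 0ℚ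

    classConstantTerm-cons : ∀ c κ → classConstantTerm y (c Vector.∷ κ) ≡ pinnedTerm κ c
    classConstantTerm-cons c κ = trans
      (cong₂ (λ b p → if b then p else 0ℚ)
             (sym (does-⇔ (classConstant-cons c κ) (Tail.classConstant? κ ×-dec (c ≟ κ w))
                          (classConstant? (c Vector.∷ κ))))
             (colourWeight-cons c κ))
      (if-∧ (does (Tail.classConstant? κ)) (does (c ≟ κ w)))

    classConstantSum-absorbed : classConstantSum y ≡ Tail.classConstantSum absorbed
    classConstantSum-absorbed = begin
      classConstantSum y
        ≡⟨ sum-allFuns-suc (classConstantTerm y) (classConstantTerm-cong y) ⟩
      sumℚ (map (λ c → sumℚ (map (λ κ → classConstantTerm y (c Vector.∷ κ)) (allFuns n m))) (allFin m))
        ≡⟨ sum-cong (λ c → sum-cong (classConstantTerm-cons c) (allFuns n m)) (allFin m) ⟩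
      sumℚ (map (λ c → sumℚ (map (λ κ → pinnedTerm κ c) (allFuns n m))) (allFin m))
        ≡⟨ sum-comm (λ c κ → pinnedTerm κ c) (allFin m) (allFuns n m) ⟩
      sumℚ (map (λ κ → sumℚ (map (pinnedTerm κ) (allFin m))) (allFuns n m))
        ≡⟨ sum-cong (λ κ → trans (sum-if (does (Tail.classConstant? κ)) _ (allFin m))
                                 (cong (λ s → if does (Tail.classConstant? κ) then s else 0ℚ) (collapse κ))) (allFuns n m) ⟩
      Tail.classConstantSum absorbed ∎
      where
      collapse : ∀ κ → sumℚ (map (λ c → if does (c ≟ κ w) then y zero c * colourWeight (y ∘ suc) κ else 0ℚ) (allFin m))
                     ≡ colourWeight absorbed κ
      collapse κ = trans (sum-delta (κ w) (λ c → y zero c * colourWeight (y ∘ suc) κ))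
                         (sym (prod-update w (λ v → y zero (κ v)) (λ v → y (suc v) (κ v))))

    ρ : Fin n
    ρ = proj₁ (Tail.classMin-exists w)

    ρ∼w : suc ρ ∼ suc w
    ρ∼w = proj₁ (proj₂ (Tail.classMin-exists w))

    ρ-min : Tail.ClassMin ρ
    ρ-min = proj₂ (proj₂ (Tail.classMin-exists w))

    classMinFactor-linked : ∀ {v} → suc v ∼ suc w → classMinFactor y (suc v) ≡ 1ℚ
    classMinFactor-linked {v} v∼w = cong (λ b → if b then classSum y (suc v) else 1ℚ)
      (dec-false (classMin? (suc v)) (λ min → ℕₚ.n≮0 (min zero (∼-trans link (∼-sym v∼w)))))

    classSum-ρ : Tail.classSum absorbed ρ ≡ classSum y zero
    classSum-ρ = sum-cong (λ c → begin
      Tail.classWeight absorbed ρ c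
        ≡⟨ prod-cong (split c) (allFin n) ⟩
      prodℚ (map (λ u → if does (u ≟ w) then y zero c * inClass c u else inClass c u) (allFin n))
        ≡⟨ prod-update w (λ _ → y zero c) (inClass c) ⟩
      y zero c * prodℚ (map (inClass c) (allFin n))
        ≡⟨ cong (y zero c *_) (prod-cong (λ u → cong (λ b → if b then y (suc u) c else 1ℚ)
                                                     (does-⇔ ∼ρ⇔∼0 (suc u ∼? suc ρ) (suc u ∼? zero))) (allFin n)) ⟩
      y zero c * prodℚ (map (λ u → if does (suc u ∼? zero) then y (suc u) c else 1ℚ) (allFin n))
        ≡⟨ sym (classWeight-zero c) ⟩
      classWeight y zero c ∎) (allFin m)
      where
      inClass : Fin m → Fin n → ℚ
      inClass c u = if does (suc u ∼? suc ρ) then y (suc u) c else 1ℚ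
      split : ∀ c u → (if does (suc u ∼? suc ρ) then absorbed u c else 1ℚ)
                      ≡ (if does (u ≟ w) then y zero c * inClass c u else inClass c u)
      split c u with u ≟ w
      ... | yes refl rewrite dec-true (suc u ∼? suc ρ) (∼-sym ρ∼w) = refl
      ... | no _ = refl
      ∼ρ⇔∼0 : ∀ {u} → (u ∼ suc ρ) ⇔ (u ∼ zero)
      ∼ρ⇔∼0 = mk⇔ (λ r → ∼-trans r (∼-sym link-ρ)) (λ r → ∼-trans r link-ρ)
        where link-ρ = ∼-trans link (∼-sym ρ∼w)

    classSum-unlinked : ∀ {v} → ¬ suc v ∼ suc w → Tail.classSum absorbed v ≡ Tail.classSum (y ∘ suc) v
    classSum-unlinked {v} v≁w = sum-cong (λ c → prod-cong (unchanged c) (allFin n)) (allFin m)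
      where
      unchanged : ∀ c u → (if does (suc u ∼? suc v) then absorbed u c else 1ℚ)
                          ≡ (if does (suc u ∼? suc v) then y (suc u) c else 1ℚ)
      unchanged c u with u ≟ w
      ... | yes refl rewrite dec-false (suc u ∼? suc v) (v≁w ∘ ∼-sym) = refl
      ... | no _ = refl

    classMinFactor-absorbed : ∀ v → Tail.classMinFactor absorbed v
      ≡ (if does (v ≟ ρ) then classSum y zero * classMinFactor y (suc v) else classMinFactor y (suc v))
    classMinFactor-absorbed v with v ≟ ρ
    ... | yes refl rewrite dec-true (Tail.classMin? v) ρ-min =
      trans classSum-ρ (sym (trans (cong (classSum y zero *_) (classMinFactor-linked ρ∼w)) (*-identityʳ _)))
    ... | no v≢ρ with suc v ∼? suc w
    ...   | yes v∼w = trans (cong (λ b → if b then Tail.classSum absorbed v else 1ℚ) (dec-false (Tail.classMin? v) ¬min))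
                            (sym (classMinFactor-linked v∼w))
      where ¬min = λ min → v≢ρ (Tail.classMin-unique min ρ-min (∼-trans v∼w (∼-sym ρ∼w)))
    ...   | no v≁w = trans (cong (λ s → if does (Tail.classMin? v) then s else 1ℚ) (classSum-unlinked v≁w))
                           (classMinFactor-suc (λ r → v≁w (∼-trans (∼-sym r) link)))

    step : Tail.classConstantSum absorbed ≡ Tail.classMinProduct absorbed → classConstantSum y ≡ classMinProduct y
    step ih = begin
      classConstantSum y               ≡⟨ classConstantSum-absorbed ⟩
      Tail.classConstantSum absorbed   ≡⟨ ih ⟩
      Tail.classMinProduct absorbed    ≡⟨ prod-cong classMinFactor-absorbed (allFin n) ⟩
      prodℚ (map (λ v → if does (v ≟ ρ) then classSum y zero * classMinFactor y (suc v)
                                          else classMinFactor y (suc v)) (allFin n))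
        ≡⟨ prod-update ρ (λ _ → classSum y zero) (classMinFactor y ∘ suc) ⟩
      classSum y zero * prodℚ (map (classMinFactor y ∘ suc) (allFin n)) ≡⟨ sym classMinProduct-suc ⟩
      classMinProduct y ∎

classConstantSum≡classMinProduct : ∀ {n m} {_∼_ : Rel (Fin n) 0ℓ} (isDecEquivalence : IsDecEquivalence _∼_)
  (y : Fin n → Fin m → ℚ) →
  ClassColourings.classConstantSum isDecEquivalence y ≡ ClassColourings.classMinProduct isDecEquivalence y
classConstantSum≡classMinProduct {ℕ.zero} {m} isDecEquivalence y
  rewrite dec-true (ClassColourings.classConstant? isDecEquivalence {m = m} (λ ())) (λ {u} → ⊥-elim (¬Fin0 u)) = refl
classConstantSum≡classMinProduct {ℕ.suc n} isDecEquivalence y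
  with any? (λ w → IsDecEquivalence._≟_ isDecEquivalence zero (suc w))
... | no isolated = ClassStep.Isolated.step isDecEquivalence y (λ w link → isolated (w , link))
                      (classConstantSum≡classMinProduct tail (y ∘ suc))
  where tail = On.isDecEquivalence suc isDecEquivalence
... | yes (w , link) = ClassStep.Linked.step isDecEquivalence y link
                         (classConstantSum≡classMinProduct tail (ClassStep.Linked.absorbed isDecEquivalence y link))
  where tail = On.isDecEquivalence suc isDecEquivalence

module _ {n : ℕ} where
  open import Data.List.Membership.DecPropositional (_≟_ {n}) using (_∈?_)

  prod-∈-Unique : (z : ℚ) {xs : List (Fin n)} → Unique xs →
    prodℚ (map (λ u → if does (u ∈? xs) then z else 1ℚ) (allFin n)) ≡ z ^ℚ length xs
  prod-∈-Unique z {[]} _ = prod-1 (allFin n)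
  prod-∈-Unique z {x ∷ xs} (x∉xs ∷ unique) = begin
    prodℚ (map (λ u → if does (u ∈? x ∷ xs) then z else 1ℚ) (allFin n))
      ≡⟨ prod-cong split (allFin n) ⟩
    prodℚ (map (λ u → if does (u ≟ x) then z * inXs u else inXs u) (allFin n))
      ≡⟨ prod-update x (λ _ → z) inXs ⟩
    z * prodℚ (map inXs (allFin n))
      ≡⟨ cong (z *_) (prod-∈-Unique z unique) ⟩
    z * (z ^ℚ length xs) ∎
    where
    inXs : Fin n → ℚ
    inXs u = if does (u ∈? xs) then z else 1ℚ
    split : (u : Fin n) → (if does (u ∈? x ∷ xs) then z else 1ℚ) ≡ (if does (u ≟ x) then z * inXs u else inXs u)
    split u with u ≟ x
    ... | yes refl rewrite dec-false (u ∈? xs) (All¬⇒¬Any x∉xs) = sym (*-identityʳ z)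
    ... | no _ = refl

module Cycles {n : ℕ} (σ : Permutation′ n) where
  open import Data.List.Membership.DecPropositional (_≟_ {n}) using (_∈?_)

  iter-+ : ∀ a b u → iter σ (a ℕ.+ b) u ≡ iter σ a (iter σ b u)
  iter-+ zero b u = refl
  iter-+ (suc a) b u = cong (σ ⟨$⟩ʳ_) (iter-+ a b u)

  iter-injective : ∀ k {u v} → iter σ k u ≡ iter σ k v → u ≡ v
  iter-injective zero eq = eq
  iter-injective (suc k) eq =
    iter-injective k (trans (sym (inverseˡ σ)) (trans (cong (σ ⟨$⟩ˡ_) eq) (inverseˡ σ)))

  iter-cancel : ∀ {i j u} → i ℕ.≤ j → iter σ i u ≡ iter σ j u → iter σ (j ℕ.∸ i) u ≡ u
  iter-cancel {i} {j} {u} i≤j eq = sym (iter-injective i (begin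
    iter σ i u                       ≡⟨ eq ⟩
    iter σ j u                       ≡⟨ cong (λ k → iter σ k u) (sym (ℕₚ.m+[n∸m]≡n i≤j)) ⟩
    iter σ (i ℕ.+ (j ℕ.∸ i)) u       ≡⟨ iter-+ i (j ℕ.∸ i) u ⟩
    iter σ i (iter σ (j ℕ.∸ i) u)    ∎))

  iter-returns : ∀ u → ∃[ d ] 0 ℕ.< d × d ℕ.≤ n × iter σ d u ≡ u
  iter-returns u with pigeonhole (ℕₚ.n<1+n n) (λ (i : Fin (suc n)) → iter σ (toℕ i) u)
  ... | i , j , i<j , eq = toℕ j ℕ.∸ toℕ i , ℕₚ.m<n⇒0<n∸m i<j
                         , ℕₚ.≤-trans (ℕₚ.m∸n≤m (toℕ j) (toℕ i)) (ℕ.s≤s⁻¹ (toℕ<n j))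
                         , iter-cancel (ℕₚ.<⇒≤ i<j) eq

  FirstReturnFrom : Fin n → ℕ → ℕ → Set
  FirstReturnFrom u k r = k ℕ.≤ r × iter σ r u ≡ u × (∀ s → k ℕ.≤ s → s ℕ.< r → iter σ s u ≢ u)

  firstReturn-spec : ∀ u fuel k → (∃[ K ] k ℕ.≤ K × K ℕ.< k ℕ.+ fuel × iter σ K u ≡ u) →
    FirstReturnFrom u k (firstReturn σ u fuel k)
  firstReturn-spec u zero k (K , k≤K , K<k+0 , _) = ⊥-elim (ℕₚ.<⇒≱ (subst (K ℕ.<_) (ℕₚ.+-identityʳ k) K<k+0) k≤K)
  firstReturn-spec u (suc fuel) k (K , k≤K , K< , ret) with iter σ k u ≟ u
  ... | yes ret-k = ℕₚ.≤-refl , ret-k , λ s k≤s s<k → ⊥-elim (ℕₚ.<⇒≱ s<k k≤s)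
  ... | no ¬ret-k with firstReturn-spec u fuel (suc k) (K , k<K , subst (K ℕ.<_) (ℕₚ.+-suc k fuel) K< , ret)
    where k<K = ℕₚ.≤∧≢⇒< k≤K (λ k≡K → ¬ret-k (subst (λ z → iter σ z u ≡ u) (sym k≡K) ret))
  ...   | k<r , ret-r , minimal = ℕₚ.<⇒≤ k<r , ret-r , earlier
    where
    earlier : ∀ s → k ℕ.≤ s → s ℕ.< firstReturn σ u fuel (suc k) → iter σ s u ≢ u
    earlier s k≤s s<r with s ℕₚ.≟ k
    ... | yes refl = ¬ret-k
    ... | no s≢k = minimal s (ℕₚ.≤∧≢⇒< k≤s (s≢k ∘ sym)) s<r

  cycLen-spec : ∀ u → FirstReturnFrom u 1 (cycLen σ u)
  cycLen-spec u with iter-returns u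
  ... | d , 0<d , d≤n , ret = firstReturn-spec u n 1 (d , 0<d , s≤s d≤n , ret)

  iter-cycLen : ∀ u → iter σ (cycLen σ u) u ≡ u
  iter-cycLen u = proj₁ (proj₂ (cycLen-spec u))

  cycLen-minimal : ∀ u s → 0 ℕ.< s → s ℕ.< cycLen σ u → iter σ s u ≢ u
  cycLen-minimal u = proj₂ (proj₂ (cycLen-spec u))

  instance
    cycLen-nonZero : ∀ {u} → ℕ.NonZero (cycLen σ u)
    cycLen-nonZero {u} = ℕ.>-nonZero (proj₁ (cycLen-spec u))

  iter-mod : ∀ k u → iter σ k u ≡ iter σ (k % cycLen σ u) u
  iter-mod k u = begin
    iter σ k u                                   ≡⟨ cong (λ j → iter σ j u) (m≡m%n+[m/n]*n k L) ⟩
    iter σ (k % L ℕ.+ (k /ℕ L) ℕ.* L) u           ≡⟨ iter-+ (k % L) _ u ⟩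
    iter σ (k % L) (iter σ ((k /ℕ L) ℕ.* L) u)    ≡⟨ cong (iter σ (k % L)) (iter-multiple (k /ℕ L)) ⟩
    iter σ (k % L) u                             ∎
    where
    L = cycLen σ u
    iter-multiple : ∀ q → iter σ (q ℕ.* L) u ≡ u
    iter-multiple zero = refl
    iter-multiple (suc q) = trans (iter-+ L (q ℕ.* L) u) (trans (cong (iter σ L) (iter-multiple q)) (iter-cycLen u))

  infix 4 _∼_
  _∼_ : Rel (Fin n) 0ℓ
  u ∼ v = ∃[ k ] iter σ k v ≡ u

  orbit : Fin n → List (Fin n)
  orbit v = applyUpTo (λ k → iter σ k v) (cycLen σ v)

  ∈-orbit⇔∼ : ∀ {u v} → u ∈ orbit v ⇔ u ∼ v
  ∈-orbit⇔∼ {u} {v} = mk⇔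
    (λ u∈ → let k , _ , u≡ = ∈-applyUpTo⁻ (λ k → iter σ k v) u∈ in k , sym u≡)
    (λ { (k , eq) → subst (_∈ orbit v) (trans (sym (iter-mod k v)) eq)
                          (∈-applyUpTo⁺ (λ k → iter σ k v) (m%n<n k (cycLen σ v))) })

  orbit-unique : ∀ v → Unique (orbit v)
  orbit-unique v = Unique.applyUpTo⁺₁ (λ k → iter σ k v) (cycLen σ v) λ {i} {j} i<j j<L eq →
    cycLen-minimal v (j ℕ.∸ i) (ℕₚ.m<n⇒0<n∸m i<j) (ℕₚ.≤-<-trans (ℕₚ.m∸n≤m j i) j<L)
                   (iter-cancel (ℕₚ.<⇒≤ i<j) eq)

  ∼-isDecEquivalence : IsDecEquivalence _∼_
  ∼-isDecEquivalence = record
    { isEquivalence = record { refl = 0 , refl ; sym = ∼-sym ; trans = ∼-trans }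
    ; _≟_ = λ u v → Dec.map ∈-orbit⇔∼ (u ∈? orbit v)
    }
    where
    ∼-trans : ∀ {u v w} → u ∼ v → v ∼ w → u ∼ w
    ∼-trans {w = w} (k , eq) (k′ , eq′) = k ℕ.+ k′ , trans (iter-+ k k′ w) (trans (cong (iter σ k) eq′) eq)
    ∼-sym : ∀ {u v} → u ∼ v → v ∼ u
    ∼-sym {u} {v} (k , eq) = L ℕ.∸ r , (begin
      iter σ (L ℕ.∸ r) u              ≡⟨ cong (iter σ (L ℕ.∸ r)) (trans (sym eq) (iter-mod k v)) ⟩
      iter σ (L ℕ.∸ r) (iter σ r v)   ≡⟨ sym (iter-+ (L ℕ.∸ r) r v) ⟩
      iter σ (L ℕ.∸ r ℕ.+ r) v        ≡⟨ cong (λ j → iter σ j v) (ℕₚ.m∸n+n≡m (ℕₚ.<⇒≤ (m%n<n k L))) ⟩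
      iter σ L v                      ≡⟨ iter-cycLen v ⟩
      v                               ∎)
      where
      L = cycLen σ v
      r = k % L

  open ClassColourings ∼-isDecEquivalence

  Invariant : ∀ {m} → (Fin n → Fin m) → Set
  Invariant κ = ∀ v → κ (σ ⟨$⟩ʳ v) ≡ κ v

  invariant? : ∀ {m} (κ : Fin n → Fin m) → Dec (Invariant κ)
  invariant? κ = all? λ v → κ (σ ⟨$⟩ʳ v) ≟ κ v

  classConstant⇔invariant : ∀ {m} {κ : Fin n → Fin m} → ClassConstant κ ⇔ Invariant κ
  classConstant⇔invariant {κ = κ} = mk⇔
    (λ const v → const (1 , refl))
    (λ inv {u} {v} → λ { (k , eq) → trans (cong κ (sym eq)) (κ-iter inv k v) })
    where
    κ-iter : Invariant κ → ∀ k v → κ (iter σ k v) ≡ κ v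
    κ-iter inv zero v = refl
    κ-iter inv (suc k) v = trans (inv (iter σ k v)) (κ-iter inv k v)

  isCycleMin⇔classMin : ∀ {v} → isCycleMin σ v ≡ true ⇔ ClassMin v
  isCycleMin⇔classMin {v} = mk⇔
    (λ isMin → λ { u (k , eq) → subst (v ≤_) (trans (sym (iter-mod k v)) eq)
                     (toWitness (applyUpTo⁻ {P = T ∘ test} (λ k → k) L (all⁺ test (upTo L) (Equivalence.from T-≡ isMin))
                                            (m%n<n k L))) })
    (λ min → Equivalence.to T-≡
               (all⁻ test (applyUpTo⁺₁ (λ k → k) L (λ {k} _ → fromWitness (min (iter σ k v) (k , refl))))))
    where
    L = cycLen σ v
    test : ℕ → Bool
    test k = ⌊ toℕ v ℕ.≤? toℕ (iter σ k v) ⌋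

  classSum-orbit : ∀ {m} (x : Fin m → ℚ) v → classSum (λ _ c → x c) v ≡ powerSum (cycLen σ v) x
  classSum-orbit x v = sum-cong (λ c → trans (prod-∈-Unique (x c) (orbit-unique v))
                                             (cong (x c ^ℚ_) (Listₚ.length-applyUpTo (λ k → iter σ k v) (cycLen σ v))))
                                (allFin _)

  powerSumP-cyc : ∀ {m} (x : Fin m → ℚ) → powerSumP (cyc σ) x
    ≡ sumℚ (map (λ κ → if does (invariant? κ) then colourMonomial x κ else 0ℚ) (allFuns n m))
  powerSumP-cyc {m} x = begin
    powerSumP (cyc σ) x
      ≡⟨ cong prodℚ (sym (Listₚ.map-∘ (filter isCycleMin? (allFin n)))) ⟩
    prodℚ (map (λ v → powerSum (cycLen σ v) x) (filter isCycleMin? (allFin n)))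
      ≡⟨ prod-filter isCycleMin? (λ v → powerSum (cycLen σ v) x) (allFin n) ⟩
    prodℚ (map (λ v → if does (isCycleMin? v) then powerSum (cycLen σ v) x else 1ℚ) (allFin n))
      ≡⟨ prod-cong (λ v → cong₂ (λ b p → if b then p else 1ℚ)
                                (does-⇔ isCycleMin⇔classMin (isCycleMin? v) (classMin? v))
                                (sym (classSum-orbit x v))) (allFin n) ⟩
    classMinProduct (λ _ c → x c)
      ≡⟨ sym (classConstantSum≡classMinProduct ∼-isDecEquivalence (λ _ c → x c)) ⟩
    classConstantSum (λ _ c → x c)
      ≡⟨ sum-cong (λ κ → cong (λ b → if b then colourMonomial x κ else 0ℚ)
                              (does-⇔ classConstant⇔invariant (classConstant? κ) (invariant? κ))) (allFuns n m) ⟩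
    sumℚ (map (λ κ → if does (invariant? κ) then colourMonomial x κ else 0ℚ) (allFuns n m)) ∎
    where
    isCycleMin? : ∀ v → Dec (isCycleMin σ v ≡ true)
    isCycleMin? v = isCycleMin σ v Data.Bool.≟ true

Connected : ∀ {n} → EdgeList n → Rel (Fin n) 0ℓ
Connected E = Star (Adj E)

module _ {n : ℕ} {E : EdgeList n} {e : Fin n × Fin n} where

  Adj-there : ∀ {u v} → Adj E u v → Adj (e ∷ E) u v
  Adj-there = Sum.map there there

  Connected-there : ∀ {u v} → Connected E u v → Connected (e ∷ E) u v
  Connected-there = Star.map Adj-there

  Chain-there : ∀ vs → Chain E vs → Chain (e ∷ E) vs
  Chain-there [] _ = tt
  Chain-there (_ ∷ []) _ = tt
  Chain-there (_ ∷ v ∷ vs) (adj , chain) = Adj-there adj , Chain-there (v ∷ vs) chain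

forest-tail : ∀ {n} {E : EdgeList n} {e} → IsForest (e ∷ E) → IsForest E
forest-tail ((_ ∷ ordered , _ ∷ unique) , acyclic) = (ordered , unique) , λ where
  (v ∷ vs , long , distinct , chain) → acyclic (v ∷ vs , long , distinct , Chain-there ((v ∷ vs) ++ [ v ]) chain)

data Path {n} (E : EdgeList n) : Fin n → Fin n → List (Fin n) → Set where
  stop : ∀ {a} → Path E a a [ a ]
  step : ∀ {a w b vs} → Adj E a w → Path E w b vs → Path E a b (a ∷ vs)

module _ {n : ℕ} {E : EdgeList n} where

  Path-there : ∀ {e a b vs} → Path E a b vs → Path (e ∷ E) a b vs
  Path-there stop = stop
  Path-there (step adj path) = step (Adj-there adj) (Path-there path)

  Path-chain : ∀ {a b c vs} → Path E a b vs → Adj E b c → Chain E (vs ++ [ c ])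
  Path-chain stop adj = adj , tt
  Path-chain (step adj′ path@stop) adj = adj′ , Path-chain path adj
  Path-chain (step adj′ path@(step _ _)) adj = adj′ , Path-chain path adj

  Path-suffix : ∀ {a w b vs} → Path E w b vs → Unique vs → a ∈ vs → ∃[ vs′ ] Path E a b vs′ × Unique vs′
  Path-suffix path@stop unique (here refl) = _ , path , unique
  Path-suffix path@(step _ _) unique (here refl) = _ , path , unique
  Path-suffix (step _ path) (_ ∷ unique) (there a∈vs) = Path-suffix path unique a∈vs

  connected⇒path : ∀ {a b} → Connected E a b → ∃[ vs ] Path E a b vs × Unique vs
  connected⇒path ε = _ , stop , [] ∷ []
  connected⇒path {a} (adj ◅ walk) with connected⇒path walk
  ... | vs , path , unique with Any.any? (a ≟_) vs
  ...   | yes a∈vs = Path-suffix path unique a∈vs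
  ...   | no a∉vs = a ∷ vs , step adj path , ¬Any⇒All¬ vs a∉vs ∷ unique

forest-unlinked : ∀ {n} {E : EdgeList n} {a b} → IsForest ((a , b) ∷ E) → ¬ Connected E a b
forest-unlinked {a = a} {b} ((a<b ∷ ordered , (ab∉E ∷ _)) , acyclic) walk with connected⇒path walk
... | _ , stop , _ = ℕₚ.<-irrefl refl a<b
... | _ , step (inj₁ ab∈E) stop , _ = All.lookup ab∉E ab∈E refl
... | _ , step (inj₂ ba∈E) stop , _ = ℕₚ.<-asym a<b (All.lookup ordered ba∈E)
... | _ , path@(step _ (step _ stop)) , unique =
  acyclic (_ , s≤s (s≤s (s≤s z≤n)) , unique , Path-chain (Path-there path) (inj₂ (here refl)))
... | _ , path@(step _ (step _ (step _ _))) , unique =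
  acyclic (_ , s≤s (s≤s (s≤s z≤n)) , unique , Path-chain (Path-there path) (inj₂ (here refl)))

module _ {n : ℕ} where

  transpose-matchˡ : (i j : Fin n) → transpose i j ⟨$⟩ʳ i ≡ j
  transpose-matchˡ i j rewrite dec-true (i ≟ i) refl = refl

  transpose-other : ∀ {i j w : Fin n} → w ≢ i → w ≢ j → transpose i j ⟨$⟩ʳ w ≡ w
  transpose-other {i} {j} {w} w≢i w≢j rewrite dec-false (w ≟ i) w≢i | dec-false (w ≟ j) w≢j = refl

ComponentPreserving : ∀ {n} → EdgeList n → Permutation′ n → Set
ComponentPreserving E σ = ∀ u → Connected E u (σ ⟨$⟩ʳ u)

transpose-componentPreserving : ∀ {n} {E : EdgeList n} i j → ComponentPreserving ((i , j) ∷ E) (transpose i j)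
transpose-componentPreserving i j w with w ≟ i
... | yes refl = inj₁ (here refl) ◅ ε
... | no _ with w ≟ j
...   | yes refl = inj₂ (here refl) ◅ ε
...   | no _ = ε

expand : ∀ {n} → EdgeList n → GA n
expand E = foldr (λ e acc → mulGA (factor e) acc) oneGA E

expand-componentPreserving : ∀ {n} (E : EdgeList n) → All (ComponentPreserving E ∘ proj₂) (expand E)
expand-componentPreserving [] = (λ _ → ε) ∷ []
expand-componentPreserving ((i , j) ∷ E) =
  Allₚ.++⁺ (Allₚ.map⁺ (All.map (λ pres u → Connected-there (pres u)) rest))
           (Allₚ.++⁺ (Allₚ.map⁺ (All.map (λ pres u → Connected-there (pres u) ◅◅ transposed _) rest)) [])
  where
  rest = expand-componentPreserving E
  transposed = transpose-componentPreserving i j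

-- Until the h-orbit of i returns to i it avoids i and j, so h ∘ₚ transpose i j follows it; at the
-- return, the transposition sends i to j.
module _ {n : ℕ} (h : Permutation′ n) (i j : Fin n) (unreached : ∀ k → iter h k i ≢ j) where
  private
    g = h ∘ₚ transpose i j

  returns-to-j : ∀ {s} → iter g s i ≡ iter h s i → iter h (suc s) i ≡ i → iter g (suc s) i ≡ j
  returns-to-j {s} eq returned = begin
    transpose i j ⟨$⟩ʳ (h ⟨$⟩ʳ iter g s i) ≡⟨ cong (λ z → transpose i j ⟨$⟩ʳ (h ⟨$⟩ʳ z)) eq ⟩
    transpose i j ⟨$⟩ʳ iter h (suc s) i    ≡⟨ cong (transpose i j ⟨$⟩ʳ_) returned ⟩
    transpose i j ⟨$⟩ʳ i                   ≡⟨ transpose-matchˡ i j ⟩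
    j                                      ∎

  tracks : ∀ s → (∃[ k ] iter g k i ≡ j) ⊎ iter g s i ≡ iter h s i
  tracks zero = inj₂ refl
  tracks (suc s) with tracks s
  ... | inj₁ found = inj₁ found
  ... | inj₂ eq with iter h (suc s) i ≟ i | iter h (suc s) i ≟ j
  ...   | yes returned | _ = inj₁ (suc s , returns-to-j {s} eq returned)
  ...   | no _ | yes reached = ⊥-elim (unreached (suc s) reached)
  ...   | no ≢i | no ≢j = inj₂ (trans (cong (λ z → transpose i j ⟨$⟩ʳ (h ⟨$⟩ʳ z)) eq) (transpose-other ≢i ≢j))

  transpose-joins-cycles : Cycles._∼_ (h ∘ₚ transpose i j) j i
  transpose-joins-cycles with Cycles.iter-returns h i
  ... | suc q , _ , _ , returned with tracks q
  ...   | inj₁ found = found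
  ...   | inj₂ eq = suc q , returns-to-j {q} eq returned

stabIndicator : ∀ {n m} → Permutation′ n → (Fin n → Fin m) → ℚ
stabIndicator σ κ = if does (Cycles.invariant? σ κ) then 1ℚ else 0ℚ

stabCoeff : ∀ {n m} → (Fin n → Fin m) → GA n → ℚ
stabCoeff κ a = sumℚ (map (λ t → proj₁ t * stabIndicator (proj₂ t) κ) a)

stabCoeff-factor : ∀ {n m} (i j : Fin n) (κ : Fin n → Fin m) (a : GA n) →
  stabCoeff κ (mulGA (factor (i , j)) a)
  ≡ stabCoeff κ a + - sumℚ (map (λ t → proj₁ t * stabIndicator (proj₂ t ∘ₚ transpose i j) κ) a)
stabCoeff-factor i j κ a = begin
  stabCoeff κ (mulGA (factor (i , j)) a)
    ≡⟨ sum-++ term (map keep a) (map swap a ++ []) ⟩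
  sumℚ (map term (map keep a)) + sumℚ (map term (map swap a ++ []))
    ≡⟨ cong (sumℚ (map term (map keep a)) +_) (sum-++ term (map swap a) []) ⟩
  sumℚ (map term (map keep a)) + (sumℚ (map term (map swap a)) + 0ℚ)
    ≡⟨ cong₂ _+_ (cong sumℚ (sym (Listₚ.map-∘ a))) (trans (+-identityʳ _) (cong sumℚ (sym (Listₚ.map-∘ a)))) ⟩
  sumℚ (map (term ∘ keep) a) + sumℚ (map (term ∘ swap) a)
    ≡⟨ cong₂ _+_ (sum-cong (λ t → cong (_* stabIndicator (proj₂ t) κ) (*-identityˡ (proj₁ t))) a)
                 (trans (sum-cong (λ t → neg-one-* (proj₁ t) _) a) (sum-neg swappedTerm a)) ⟩
  stabCoeff κ a + - sumℚ (map (λ t → proj₁ t * stabIndicator (proj₂ t ∘ₚ transpose i j) κ) a) ∎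
  where
  term = λ (t : ℚ × Permutation′ _) → proj₁ t * stabIndicator (proj₂ t) κ
  keep = λ (t : ℚ × Permutation′ _) → (1ℚ * proj₁ t , proj₂ t ∘ₚ id)
  swap = λ (t : ℚ × Permutation′ _) → (- 1ℚ * proj₁ t , proj₂ t ∘ₚ transpose i j)
  swappedTerm = λ (t : ℚ × Permutation′ _) → proj₁ t * stabIndicator (proj₂ t ∘ₚ transpose i j) κ
  neg-one-* : ∀ c d → (- 1ℚ * c) * d ≡ - (c * d)
  neg-one-* = solve 2 (λ c d → ((:- con 1ℚ) :* c) :* d := :- (c :* d)) refl

module _ {n m : ℕ} {κ : Fin n → Fin m} {i j : Fin n} where

  κ-transpose : κ i ≡ κ j → ∀ w → κ (transpose i j ⟨$⟩ʳ w) ≡ κ w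
  κ-transpose κi≡κj w with w ≟ i
  ... | yes refl = sym κi≡κj
  ... | no _ with w ≟ j
  ...   | yes refl = κi≡κj
  ...   | no _ = refl

  invariant-∘-transpose : κ i ≡ κ j → ∀ σ → Cycles.Invariant (σ ∘ₚ transpose i j) κ ⇔ Cycles.Invariant σ κ
  invariant-∘-transpose κi≡κj σ = mk⇔ (λ inv v → trans (sym (κ-transpose κi≡κj (σ ⟨$⟩ʳ v))) (inv v))
                                      (λ inv v → trans (κ-transpose κi≡κj (σ ⟨$⟩ʳ v)) (inv v))

  ¬invariant-∘-transpose : ∀ {E : EdgeList n} → ¬ Connected E i j → κ i ≢ κ j →
    ∀ σ → ComponentPreserving E σ → ¬ Cycles.Invariant (σ ∘ₚ transpose i j) κ
  ¬invariant-∘-transpose {E} disconnected κi≢κj σ preserving invariant =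
    κi≢κj (sym (Equivalence.from (Cycles.classConstant⇔invariant (σ ∘ₚ transpose i j)) invariant
                                 (transpose-joins-cycles σ i j unreached)))
    where
    reaches : ∀ k → Connected E i (iter σ k i)
    reaches zero = ε
    reaches (suc k) = reaches k ◅◅ preserving (iter σ k i)
    unreached : ∀ k → iter σ k i ≢ j
    unreached k reached = disconnected (subst (Connected E i) reached (reaches k))

stabCoeff-expand : ∀ {n m} (E : EdgeList n) → IsForest E → (κ : Fin n → Fin m) →
  stabCoeff κ (expand E) ≡ (if proper E κ then 1ℚ else 0ℚ)
stabCoeff-expand [] _ κ rewrite dec-true (Cycles.invariant? id κ) (λ _ → refl) = refl
stabCoeff-expand ((i , j) ∷ E) forest κ with κ i ≟ κ j
... | yes κi≡κj = begin
  stabCoeff κ (expand ((i , j) ∷ E))                  ≡⟨ stabCoeff-factor i j κ (expand E) ⟩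
  stabCoeff κ (expand E) + - swapped                  ≡⟨ cong (λ s → stabCoeff κ (expand E) + - s)
                                                               (sum-cong same (expand E)) ⟩
  stabCoeff κ (expand E) + - stabCoeff κ (expand E)   ≡⟨ +-inverseʳ (stabCoeff κ (expand E)) ⟩
  0ℚ                                                  ∎
  where
  swapped = sumℚ (map (λ t → proj₁ t * stabIndicator (proj₂ t ∘ₚ transpose i j) κ) (expand E))
  same : ∀ t → proj₁ t * stabIndicator (proj₂ t ∘ₚ transpose i j) κ ≡ proj₁ t * stabIndicator (proj₂ t) κ
  same (c , σ) = cong (λ b → c * (if b then 1ℚ else 0ℚ))
                      (does-⇔ (invariant-∘-transpose κi≡κj σ)
                              (Cycles.invariant? (σ ∘ₚ transpose i j) κ) (Cycles.invariant? σ κ))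
... | no κi≢κj = begin
  stabCoeff κ (expand ((i , j) ∷ E))      ≡⟨ stabCoeff-factor i j κ (expand E) ⟩
  stabCoeff κ (expand E) + - swapped      ≡⟨ cong (λ s → stabCoeff κ (expand E) + - s)
                                                   (sum-0-All (All.map (λ {t} → vanishes {t}) (expand-componentPreserving E))) ⟩
  stabCoeff κ (expand E) + 0ℚ             ≡⟨ +-identityʳ _ ⟩
  stabCoeff κ (expand E)                  ≡⟨ stabCoeff-expand E (forest-tail forest) κ ⟩
  (if proper E κ then 1ℚ else 0ℚ)        ∎
  where
  swapped = sumℚ (map (λ t → proj₁ t * stabIndicator (proj₂ t ∘ₚ transpose i j) κ) (expand E))
  vanishes : ∀ {t} → ComponentPreserving E (proj₂ t) → proj₁ t * stabIndicator (proj₂ t ∘ₚ transpose i j) κ ≡ 0ℚ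
  vanishes {c , σ} preserving =
    trans (cong (λ b → c * (if b then 1ℚ else 0ℚ))
                (dec-false (Cycles.invariant? (σ ∘ₚ transpose i j) κ)
                           (¬invariant-∘-transpose (forest-unlinked forest) κi≢κj σ preserving)))
          (*-zeroʳ c)

factorial-inverse : ∀ d .{{_ : ℕ.NonZero d}} → (ℤ.+ d) / 1 * ((ℤ.+ 1) / d) ≡ 1ℚ
factorial-inverse (suc d) = trans
  (cong₂ _*_ (normalize-coprime (Coprime.sym (1-coprimeTo (suc d)))) (normalize-coprime (1-coprimeTo (suc d))))
  (*-inverseʳ (mkℚ (ℤ.+ suc d) 0 (Coprime.sym (1-coprimeTo (suc d)))))

ch-scale-factorial : ∀ {n m} (a : GA n) (x : Fin m → ℚ) →
  ch (scaleGA ((ℤ.+ (n ℕ.!)) / 1) a) x ≡ sumℚ (map (λ t → proj₁ t * powerSumP (cyc (proj₂ t)) x) a)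
ch-scale-factorial {n} a x = trans (cong sumℚ (sym (Listₚ.map-∘ a))) (sum-cong cancel a)
  where
  N = (ℤ.+ (n ℕ.!)) / 1
  N⁻¹ = ((ℤ.+ 1) / (n ℕ.!)) {{n !≢0}}
  regroup : ∀ N c k p → ((N * c) * k) * p ≡ (N * k) * (c * p)
  regroup = solve 4 (λ N c k p → ((N :* c) :* k) :* p := (N :* k) :* (c :* p)) refl
  cancel : ∀ (t : ℚ × Permutation′ n) →
    ((N * proj₁ t) * N⁻¹) * powerSumP (cyc (proj₂ t)) x ≡ proj₁ t * powerSumP (cyc (proj₂ t)) x
  cancel (c , σ) = trans (regroup N c N⁻¹ p)
    (trans (cong (_* (c * p)) (factorial-inverse (n ℕ.!) {{n !≢0}})) (*-identityˡ (c * p)))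
    where p = powerSumP (cyc σ) x

frobenius-as-colourings : ∀ {n m} (a : GA n) (x : Fin m → ℚ) →
  sumℚ (map (λ t → proj₁ t * powerSumP (cyc (proj₂ t)) x) a)
  ≡ sumℚ (map (λ κ → stabCoeff κ a * colourMonomial x κ) (allFuns n m))
frobenius-as-colourings {n} {m} a x = begin
  sumℚ (map (λ t → proj₁ t * powerSumP (cyc (proj₂ t)) x) a)
    ≡⟨ sum-cong (λ t → trans (cong (proj₁ t *_) (Cycles.powerSumP-cyc (proj₂ t) x))
                             (sym (sum-*ˡ (proj₁ t) _ (allFuns n m)))) a ⟩
  sumℚ (map (λ t → sumℚ (map (λ κ → proj₁ t * invariantWeight (proj₂ t) κ) (allFuns n m))) a)
    ≡⟨ sum-comm (λ t κ → proj₁ t * invariantWeight (proj₂ t) κ) a (allFuns n m) ⟩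
  sumℚ (map (λ κ → sumℚ (map (λ t → proj₁ t * invariantWeight (proj₂ t) κ) a)) (allFuns n m))
    ≡⟨ sum-cong (λ κ → trans (sum-cong (λ t → split (proj₁ t) (does (Cycles.invariant? (proj₂ t) κ))) a)
                             (sum-*ʳ (w κ) (λ t → proj₁ t * stabIndicator (proj₂ t) κ) a)) (allFuns n m) ⟩
  sumℚ (map (λ κ → stabCoeff κ a * w κ) (allFuns n m)) ∎
  where
  w = colourMonomial x
  invariantWeight : Permutation′ n → (Fin n → Fin m) → ℚ
  invariantWeight σ κ = if does (Cycles.invariant? σ κ) then w κ else 0ℚ
  split : ∀ {κ} c b → c * (if b then w κ else 0ℚ) ≡ (c * (if b then 1ℚ else 0ℚ)) * w κ
  split {κ} c true = cong (_* w κ) (sym (*-identityʳ c))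
  split {κ} c false = trans (*-zeroʳ c) (sym (trans (cong (_* w κ) (*-zeroʳ c)) (*-zeroˡ (w κ))))

chromatic-as-sum : ∀ {n m} (E : EdgeList n) (x : Fin m → ℚ) →
  sumℚ (map (λ κ → (if proper E κ then 1ℚ else 0ℚ) * colourMonomial x κ) (allFuns n m)) ≡ chromatic E x
chromatic-as-sum {n} {m} E x =
  trans (sum-cong indicator (allFuns n m))
        (sym (sum-filter (λ κ → proper E κ Data.Bool.≟ true) (colourMonomial x) (allFuns n m)))
  where
  indicator : ∀ κ → (if proper E κ then 1ℚ else 0ℚ) * colourMonomial x κ
                    ≡ (if does (proper E κ Data.Bool.≟ true) then colourMonomial x κ else 0ℚ)
  indicator κ with proper E κ
  ... | true = *-identityˡ (colourMonomial x κ)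
  ... | false = *-zeroˡ (colourMonomial x κ)

theorem2p5 : (n : ℕ) (E : EdgeList n) → IsForest E →
    (m : ℕ) (x : Fin m → ℚ) → ch (alpha n E) x ≡ chromatic E x
theorem2p5 n E forest m x = begin
  ch (alpha n E) x
    ≡⟨ ch-scale-factorial (expand E) x ⟩
  sumℚ (map (λ t → proj₁ t * powerSumP (cyc (proj₂ t)) x) (expand E))
    ≡⟨ frobenius-as-colourings (expand E) x ⟩
  sumℚ (map (λ κ → stabCoeff κ (expand E) * colourMonomial x κ) (allFuns n m))
    ≡⟨ sum-cong (λ κ → cong (_* colourMonomial x κ) (stabCoeff-expand E forest κ)) (allFuns n m) ⟩
  sumℚ (map (λ κ → (if proper E κ then 1ℚ else 0ℚ) * colourMonomial x κ) (allFuns n m))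
    ≡⟨ chromatic-as-sum E x ⟩
  chromatic E x ∎
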